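{- If $G$ is a comparability graph such that $\mathcal{C}_G$ has $k$ equivalence classes, then $G$ has exactly $2^k$ quasi-transitive orientations.
   Context: A comparability graph is a graph admitting a transitive orientation. A quasi-transitive orientation of a graph $G$ is an orientation of its edges such that whenever $u\to v$ and $v\to w$ are arcs with $u\neq w$, the vertices $u$ and $w$ are adjacent. A quasi-transitive $2$-edge-colouring of $G$ is a map $c: E(G)\to\{R,B\}$ such that for all pairs of edges $xy, yz \in E(G)$ with $c(xy)\neq c(yz)$, we have $xz\in E(G)$. $\mathcal{C}_G$ is the equivalence relation on $E(G)$ with $e\sim f$ iff $c(e)=c(f)$ for every quasi-transitive $2$-edge-colouring $c$ of $G$. -}

module Defs where

open import Data.Nat using (ℕ)
open import Data.Fin using (Fin; _<_)
open import Data.Bool using (Bool; true; false; not)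
open import Data.Product using (Σ; ∃; _×_; _,_; proj₁; proj₂)
open import Relation.Binary.PropositionalEquality using (_≡_; _≢_)
open import Function.Bundles using (_⇔_)

record Graph (n : ℕ) : Set where
  field
    adj    : Fin n → Fin n → Bool
    sym    : ∀ u v → adj u v ≡ adj v u
    irrefl : ∀ u → adj u u ≡ false

module _ {n : ℕ} (G : Graph n) where
  open Graph G

  Adj : Fin n → Fin n → Set
  Adj u v = adj u v ≡ true

  -- A candidate orientation: O u v ≡ true means the arc u → v.
  Orient : Set
  Orient = Fin n → Fin n → Bool

  IsOrientation : Orient → Set
  IsOrientation O =
    (∀ u v → O u v ≡ true → Adj u v) ×
    (∀ u v → Adj u v → O v u ≡ not (O u v))

  IsTransitiveOrientation : Orient → Set
  IsTransitiveOrientation O =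
    IsOrientation O ×
    (∀ u v w → O u v ≡ true → O v w ≡ true → O u w ≡ true)

  IsQuasiTransitiveOrientation : Orient → Set
  IsQuasiTransitiveOrientation O =
    IsOrientation O ×
    (∀ u v w → O u v ≡ true → O v w ≡ true → u ≢ w → Adj u w)

  IsComparability : Set
  IsComparability = Σ Orient IsTransitiveOrientation

  data Colour : Set where
    R B : Colour

  -- An edge colouring is given by its values c u v on adjacent pairs;
  -- it must be symmetric on edges (it is a colouring of unordered edges).
  Colouring : Set
  Colouring = Fin n → Fin n → Colour

  IsQTColouring : Colouring → Set
  IsQTColouring c =
    (∀ u v → Adj u v → c u v ≡ c v u) ×
    (∀ x y z → Adj x y → Adj y z → c x y ≢ c y z → Adj x z)

  -- Edges of G, each represented once as (u , v) with u < v.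
  Edge : Set
  Edge = Σ (Fin n) λ u → Σ (Fin n) λ v → (u < v) × Adj u v

  colourOf : Colouring → Edge → Colour
  colourOf c (u , v , _) = c u v

  C-rel : Edge → Edge → Set
  C-rel e f = ∀ c → IsQTColouring c → colourOf c e ≡ colourOf c f

  -- 𝒞_G has exactly k equivalence classes: there is a surjection onto Fin k
  -- whose fibres are exactly the 𝒞_G-classes.
  HasClasses : ℕ → Set
  HasClasses k =
    Σ (Edge → Fin k) λ cls →
      (∀ i → ∃ λ e → cls e ≡ i) ×
      (∀ e f → C-rel e f ⇔ (cls e ≡ cls f))

  _≈O_ : Orient → Orient → Set
  O ≈O O' = ∀ u v → O u v ≡ O' u v

  -- G has exactly m quasi-transitive orientations (counted up to
  -- pointwise equality): an injective enumeration by Fin m hitting all.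
  HasExactlyQTOrientations : ℕ → Set
  HasExactlyQTOrientations m =
    Σ (Fin m → Orient) λ f →
      (∀ i → IsQuasiTransitiveOrientation (f i)) ×
      (∀ i j → f i ≈O f j → i ≡ j) ×
      (∀ O → IsQuasiTransitiveOrientation O → ∃ λ i → O ≈O f i)

-- Fix one quasi-transitive orientation T (a transitive one exists by
-- hypothesis). On an induced path u - v - w a quasi-transitive orientation
-- points both edges towards v or both away from v. Hence for any other
-- quasi-transitive orientation O the edge labelling T ⊕ O is constant on
-- induced paths, i.e. it is a quasi-transitive 2-edge-colouring, so it is
-- constant on every 𝒞_G-class. Conversely, the two edges of an induced path
-- are 𝒞_G-related, so flipping T on a union of 𝒞_G-classes flips both or
-- neither, and the result is again quasi-transitive. Thus quasi-transitive
-- orientations correspond to the subsets of the k classes.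
module Submission where

open import Defs
open import Data.Nat using (ℕ; zero; suc; _^_)
open import Data.Fin using (Fin; _<_; combine; funToFin; finToFun)
open import Data.Fin.Properties
  using (<-cmp; <-asym; <-irrelevant; 2↔Bool; funToFin-finToFin; finToFun-funToFin)
  renaming (_≟_ to _≟ᶠ_)
open import Data.Bool using (Bool; true; false; not; _xor_)
open import Data.Bool.Properties using (not-distribˡ-xor; xor-assoc; xor-same)
  renaming (_≟_ to _≟ᵇ_)
open import Data.Product using (∃; _×_; _,_; proj₁)
open import Data.Empty using (⊥-elim)
open import Function.Base using (_∘_)
open import Function.Bundles using (Inverse; Equivalence)
open import Relation.Nullary using (¬_; Dec; yes; no; contradiction)
open import Relation.Binary.Definitions using (DecidableEquality; tri<; tri≈; tri>)
open import Relation.Binary.PropositionalEquality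
open import Axiom.UniquenessOfIdentityProofs using (module Decidable⇒UIP)

_⊕_ : {A : Set} → (A → A → Bool) → (A → A → Bool) → A → A → Bool
(s ⊕ t) u v = s u v xor t u v

xor-involutiveˡ : ∀ a x → a xor (a xor x) ≡ x
xor-involutiveˡ a x = begin
  a xor (a xor x) ≡⟨ xor-assoc a a x ⟨
  (a xor a) xor x ≡⟨ cong (_xor x) (xor-same a) ⟩
  x               ∎
  where open ≡-Reasoning

xor-cancelˡ : ∀ a {x y} → a xor x ≡ a xor y → x ≡ y
xor-cancelˡ a {x} {y} eq =
  trans (sym (xor-involutiveˡ a x)) (trans (cong (a xor_) eq) (xor-involutiveˡ a y))

xor-reverseˡ : ∀ {a b s s'} → a ≡ not b → s ≡ s' → a xor s ≡ not (b xor s')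
xor-reverseˡ {b = b} {s' = s'} refl refl = sym (not-distribˡ-xor b s')

xor-of-reversals : ∀ {a b c d} → a ≡ not b → c ≡ not d → a xor c ≡ b xor d
xor-of-reversals {b = false} {d = false} refl refl = refl
xor-of-reversals {b = false} {d = true}  refl refl = refl
xor-of-reversals {b = true}  {d = false} refl refl = refl
xor-of-reversals {b = true}  {d = true}  refl refl = refl

bitsOf : ∀ {k} → Fin (2 ^ k) → Fin k → Bool
bitsOf {k} i = Inverse.to 2↔Bool ∘ finToFun {2} {k} i

funToFin-cong : ∀ {m n} {f g : Fin m → Fin n} → (∀ x → f x ≡ g x) → funToFin f ≡ funToFin g
funToFin-cong {zero}  f≗g = refl
funToFin-cong {suc m} f≗g = cong₂ combine (f≗g Fin.zero) (funToFin-cong (f≗g ∘ Fin.suc))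

bitsOf-injective : ∀ {k} (i j : Fin (2 ^ k)) → (∀ t → bitsOf i t ≡ bitsOf j t) → i ≡ j
bitsOf-injective {k} i j same = begin
  i                             ≡⟨ funToFin-finToFin {k} {2} i ⟨
  funToFin (finToFun {2} {k} i) ≡⟨ funToFin-cong sameDigits ⟩
  funToFin (finToFun {2} {k} j) ≡⟨ funToFin-finToFin {k} {2} j ⟩
  j                             ∎
  where
  open ≡-Reasoning
  open Inverse 2↔Bool using (from; strictlyInverseʳ)
  sameDigits : ∀ t → finToFun {2} {k} i t ≡ finToFun {2} {k} j t
  sameDigits t = trans (sym (strictlyInverseʳ _))
                       (trans (cong from (same t)) (strictlyInverseʳ _))

bitsOf-surjective : ∀ {k} (β : Fin k → Bool) → ∃ λ i → ∀ t → bitsOf i t ≡ β t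
bitsOf-surjective {k} β = funToFin (from ∘ β) , λ t →
  trans (cong to (finToFun-funToFin {k} {2} (from ∘ β) t)) (strictlyInverseˡ (β t))
  where open Inverse 2↔Bool using (to; from; strictlyInverseˡ)

module _ {n : ℕ} (G : Graph n) where
  open Graph G renaming (sym to adj-sym)

  Adj? : ∀ u v → Dec (Adj G u v)
  Adj? u v = adj u v ≟ᵇ true

  Adj-sym : ∀ {u v} → Adj G u v → Adj G v u
  Adj-sym {u} {v} a = trans (adj-sym v u) a

  Adj⇒≢ : ∀ {u v} → Adj G u v → u ≢ v
  Adj⇒≢ {u} a refl with trans (sym a) (irrefl u)
  ... | ()

  Adj-irrelevant : ∀ {u v} (a a' : Adj G u v) → a ≡ a'
  Adj-irrelevant = Decidable⇒UIP.≡-irrelevant _≟ᵇ_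

  IsInducedP₃ : Fin n → Fin n → Fin n → Set
  IsInducedP₃ u v w = Adj G u v × Adj G v w × u ≢ w × ¬ Adj G u w

  SupportedOnEdges : (Fin n → Fin n → Bool) → Set
  SupportedOnEdges s = ∀ u v → s u v ≡ true → Adj G u v

  SymmetricOnEdges : (Fin n → Fin n → Bool) → Set
  SymmetricOnEdges s = ∀ u v → Adj G u v → s v u ≡ s u v

  ConstantOnP₃ : (Fin n → Fin n → Bool) → Set
  ConstantOnP₃ s = ∀ {u v w} → IsInducedP₃ u v w → s u v ≡ s v w

  supported⇒false : ∀ {s} → SupportedOnEdges s → ∀ {u v} → ¬ Adj G u v → s u v ≡ false
  supported⇒false {s} supp {u} {v} ¬a with s u v in e
  ... | true  = contradiction (supp u v e) ¬a
  ... | false = refl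

  ≈O-fromEdges : ∀ {O O'} → SupportedOnEdges O → SupportedOnEdges O' →
                 (∀ u v → Adj G u v → O u v ≡ O' u v) → _≈O_ G O O'
  ≈O-fromEdges supp supp' agree u v with Adj? u v
  ... | yes a = agree u v a
  ... | no ¬a = trans (supported⇒false supp ¬a) (sym (supported⇒false supp' ¬a))

  edge : ∀ {u v} → Adj G u v → Edge G
  edge {u} {v} a with <-cmp u v
  ... | tri< u<v _ _ = u , v , u<v , a
  ... | tri≈ _ u≡v _ = ⊥-elim (Adj⇒≢ a u≡v)
  ... | tri> _ _ v<u = v , u , v<u , Adj-sym a

  edge-irrelevant : ∀ {u v} {p p' : u < v} {a a' : Adj G u v} →
                    _≡_ {A = Edge G} (u , v , p , a) (u , v , p' , a')
  edge-irrelevant {u} {v} {p} {p'} {a} {a'} =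
    cong₂ (λ p a → u , v , p , a) (<-irrelevant p p') (Adj-irrelevant a a')

  edge-sorted : ∀ {u v} (p : u < v) (a : Adj G u v) → edge a ≡ (u , v , p , a)
  edge-sorted {u} {v} p a with <-cmp u v
  ... | tri< _ _ _   = edge-irrelevant
  ... | tri≈ _ u≡v _ = ⊥-elim (Adj⇒≢ a u≡v)
  ... | tri> _ _ v<u = ⊥-elim (<-asym p v<u)

  edge-sym : ∀ {u v} (a : Adj G u v) (a' : Adj G v u) → edge a ≡ edge a'
  edge-sym {u} {v} a a' with <-cmp u v | <-cmp v u
  ... | tri< _ _ _   | tri> _ _ _   = edge-irrelevant
  ... | tri> _ _ _   | tri< _ _ _   = edge-irrelevant
  ... | tri< p _ _   | tri< q _ _   = ⊥-elim (<-asym p q)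
  ... | tri> _ _ p   | tri> _ _ q   = ⊥-elim (<-asym p q)
  ... | tri≈ _ u≡v _ | _            = ⊥-elim (Adj⇒≢ a u≡v)
  ... | _            | tri≈ _ v≡u _ = ⊥-elim (Adj⇒≢ a' v≡u)

  colourOf-edge : ∀ c → (∀ x y → Adj G x y → c x y ≡ c y x) →
                  ∀ {u v} (a : Adj G u v) → colourOf G c (edge a) ≡ c u v
  colourOf-edge c c-sym {u} {v} a with <-cmp u v
  ... | tri< _ _ _   = refl
  ... | tri≈ _ u≡v _ = ⊥-elim (Adj⇒≢ a u≡v)
  ... | tri> _ _ _   = c-sym v u (Adj-sym a)

  QT-reversesOnP₃ : ∀ {O} → IsQuasiTransitiveOrientation G O → ∀ {u v w} →
                    IsInducedP₃ u v w → O u v ≡ not (O v w)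
  QT-reversesOnP₃ {O} ((_ , rev) , qt) {u} {v} {w} (uv , vw , u≢w , ¬uw)
    with O u v in e₁ | O v w in e₂
  ... | true  | true  = contradiction (qt u v w e₁ e₂ u≢w) ¬uw
  ... | true  | false = refl
  ... | false | true  = refl
  ... | false | false = contradiction (Adj-sym (qt w v u wv vu (u≢w ∘ sym))) ¬uw
    where
    wv : O w v ≡ true
    wv = trans (rev v w vw) (cong not e₂)
    vu : O v u ≡ true
    vu = trans (rev u v uv) (cong not e₁)

  transitive⇒quasiTransitive : ∀ {O} → IsTransitiveOrientation G O →
                               IsQuasiTransitiveOrientation G O
  transitive⇒quasiTransitive (orient , transitive) =
    orient , λ u v w uv vw _ → proj₁ orient u w (transitive u v w uv vw)

  ⊕-supported : ∀ {s t} → SupportedOnEdges s → SupportedOnEdges t → SupportedOnEdges (s ⊕ t)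
  ⊕-supported s-supp t-supp u v e with Adj? u v
  ... | yes a = a
  ... | no ¬a
    with trans (sym e) (cong₂ _xor_ (supported⇒false s-supp ¬a) (supported⇒false t-supp ¬a))
  ...   | ()

  ⊕-QT : ∀ {O s} → IsQuasiTransitiveOrientation G O → SupportedOnEdges s →
         SymmetricOnEdges s → ConstantOnP₃ s → IsQuasiTransitiveOrientation G (O ⊕ s)
  ⊕-QT {O} {s} isQT@((supp , rev) , _) s-supp s-sym s-P₃ = (supp⊕ , rev⊕) , qt⊕
    where
    supp⊕ = ⊕-supported supp s-supp
    rev⊕ : ∀ u v → Adj G u v → (O ⊕ s) v u ≡ not ((O ⊕ s) u v)
    rev⊕ u v a = xor-reverseˡ (rev u v a) (s-sym u v a)
    qt⊕ : ∀ u v w → (O ⊕ s) u v ≡ true → (O ⊕ s) v w ≡ true → u ≢ w → Adj G u w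
    qt⊕ u v w e₁ e₂ u≢w with Adj? u w
    ... | yes a = a
    ... | no ¬a with trans (sym e₁) (trans reversed (cong not e₂))
      where
      p₃ = supp⊕ u v e₁ , supp⊕ v w e₂ , u≢w , ¬a
      reversed : (O ⊕ s) u v ≡ not ((O ⊕ s) v w)
      reversed = xor-reverseˡ (QT-reversesOnP₃ isQT p₃) (s-P₃ p₃)
    ...   | ()

  ⊕-symmetric : ∀ {O O'} → IsOrientation G O → IsOrientation G O' → SymmetricOnEdges (O ⊕ O')
  ⊕-symmetric (_ , rev) (_ , rev') u v a = xor-of-reversals (rev u v a) (rev' u v a)

  ⊕-constantOnP₃ : ∀ {O O'} → IsQuasiTransitiveOrientation G O →
                   IsQuasiTransitiveOrientation G O' → ConstantOnP₃ (O ⊕ O')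
  ⊕-constantOnP₃ isQT isQT' p₃ =
    xor-of-reversals (QT-reversesOnP₃ isQT p₃) (QT-reversesOnP₃ isQT' p₃)

  toColour : Bool → Colour G
  toColour true  = R
  toColour false = B

  toColour-injective : ∀ {x y} → toColour x ≡ toColour y → x ≡ y
  toColour-injective {true}  {true}  _ = refl
  toColour-injective {false} {false} _ = refl

  _≟ᶜ_ : DecidableEquality (Colour G)
  R ≟ᶜ R = yes refl
  R ≟ᶜ B = no λ ()
  B ≟ᶜ R = no λ ()
  B ≟ᶜ B = yes refl

  labelling-QTColouring : ∀ {s} → SymmetricOnEdges s → ConstantOnP₃ s →
                          IsQTColouring G (λ u v → toColour (s u v))
  labelling-QTColouring {s} s-sym s-P₃ = colour-sym , colour-qt
    where
    colour-sym : ∀ u v → Adj G u v → toColour (s u v) ≡ toColour (s v u)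
    colour-sym u v a = cong toColour (sym (s-sym u v a))
    colour-qt : ∀ x y z → Adj G x y → Adj G y z →
                toColour (s x y) ≢ toColour (s y z) → Adj G x z
    colour-qt x y z xy yz differ with Adj? x z | x ≟ᶠ z
    ... | yes a | _        = a
    ... | no _  | yes refl = contradiction (colour-sym x y xy) differ
    ... | no ¬a | no x≢z   = contradiction (cong toColour (s-P₃ (xy , yz , x≢z , ¬a))) differ

  P₃⇒C-rel : ∀ {u v w} (uv : Adj G u v) (vw : Adj G v w) → ¬ Adj G u w →
             C-rel G (edge uv) (edge vw)
  P₃⇒C-rel {u} {v} {w} uv vw ¬uw c (c-sym , c-qt) = begin
    colourOf G c (edge uv) ≡⟨ colourOf-edge c c-sym uv ⟩
    c u v                  ≡⟨ sameColour ⟩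
    c v w                  ≡⟨ colourOf-edge c c-sym vw ⟨
    colourOf G c (edge vw) ∎
    where
    open ≡-Reasoning
    sameColour : c u v ≡ c v w
    sameColour with c u v ≟ᶜ c v w
    ... | yes same  = same
    ... | no differ = contradiction (c-qt u v w uv vw differ) ¬uw

  HasExactlyQTOrientations-2^ : ∀ {k} (enum : (Fin k → Bool) → Orient G) →
    (∀ {β β'} → (∀ t → β t ≡ β' t) → _≈O_ G (enum β) (enum β')) →
    (∀ β → IsQuasiTransitiveOrientation G (enum β)) →
    (∀ {β β'} → _≈O_ G (enum β) (enum β') → ∀ t → β t ≡ β' t) →
    (∀ O → IsQuasiTransitiveOrientation G O → ∃ λ β → _≈O_ G O (enum β)) →
    HasExactlyQTOrientations G (2 ^ k)
  HasExactlyQTOrientations-2^ enum enum-cong enum-QT enum-injective enum-surjective =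
    enum ∘ bitsOf , enum-QT ∘ bitsOf , injective , surjective
    where
    injective : ∀ i j → _≈O_ G (enum (bitsOf i)) (enum (bitsOf j)) → i ≡ j
    injective i j same = bitsOf-injective i j (enum-injective same)
    surjective : ∀ O → IsQuasiTransitiveOrientation G O → ∃ λ i → _≈O_ G O (enum (bitsOf i))
    surjective O isQT with enum-surjective O isQT
    ... | β , O≈ with bitsOf-surjective β
    ...   | i , bits≗β = i , λ u v → trans (O≈ u v) (enum-cong (sym ∘ bits≗β) u v)

  module Twist {k : ℕ} (cls : Edge G → Fin k) where

    -- β is read as a set of 𝒞_G-classes; off the edges the label is false.
    classLabel : (Fin k → Bool) → Fin n → Fin n → Bool
    classLabel β u v with Adj? u v
    ... | yes a = β (cls (edge a))
    ... | no _  = false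

    twist : Orient G → (Fin k → Bool) → Orient G
    twist O β = O ⊕ classLabel β

    classLabel-adj : ∀ β {u v} (a : Adj G u v) → classLabel β u v ≡ β (cls (edge a))
    classLabel-adj β {u} {v} a with Adj? u v
    ... | yes a' = cong (β ∘ cls ∘ edge) (Adj-irrelevant a' a)
    ... | no ¬a  = contradiction a ¬a

    classLabel-supported : ∀ β → SupportedOnEdges (classLabel β)
    classLabel-supported β u v e with Adj? u v
    ... | yes a = a

    classLabel-symmetric : ∀ β → SymmetricOnEdges (classLabel β)
    classLabel-symmetric β u v a = begin
      classLabel β v u           ≡⟨ classLabel-adj β (Adj-sym a) ⟩
      β (cls (edge (Adj-sym a))) ≡⟨ cong (β ∘ cls) (edge-sym a (Adj-sym a)) ⟨
      β (cls (edge a))           ≡⟨ classLabel-adj β a ⟨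
      classLabel β u v           ∎
      where open ≡-Reasoning

    classLabel-cong : ∀ {β β'} → (∀ t → β t ≡ β' t) → ∀ u v → classLabel β u v ≡ classLabel β' u v
    classLabel-cong β≗β' u v with Adj? u v
    ... | yes a = β≗β' _
    ... | no _  = refl

    twist-cong : ∀ O {β β'} → (∀ t → β t ≡ β' t) → _≈O_ G (twist O β) (twist O β')
    twist-cong O β≗β' u v = cong (O u v xor_) (classLabel-cong β≗β' u v)

    module _ (cls-sound : ∀ e f → C-rel G e f → cls e ≡ cls f) where

      classLabel-constantOnP₃ : ∀ β → ConstantOnP₃ (classLabel β)
      classLabel-constantOnP₃ β (uv , vw , _ , ¬uw) = begin
        classLabel β _ _  ≡⟨ classLabel-adj β uv ⟩
        β (cls (edge uv)) ≡⟨ cong β (cls-sound _ _ (P₃⇒C-rel uv vw ¬uw)) ⟩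
        β (cls (edge vw)) ≡⟨ classLabel-adj β vw ⟨
        classLabel β _ _  ∎
        where open ≡-Reasoning

      twist-QT : ∀ {O} → IsQuasiTransitiveOrientation G O → ∀ β →
                 IsQuasiTransitiveOrientation G (twist O β)
      twist-QT isQT β = ⊕-QT isQT (classLabel-supported β) (classLabel-symmetric β)
                                 (classLabel-constantOnP₃ β)

    twist-injective : (∀ t → ∃ λ e → cls e ≡ t) →
                      ∀ O {β β'} → _≈O_ G (twist O β) (twist O β') → ∀ t → β t ≡ β' t
    twist-injective cls-surjective O {β} {β'} same t with cls-surjective t
    ... | (u , v , u<v , a) , refl = begin
      β (cls (u , v , u<v , a))  ≡⟨ cong (β ∘ cls) (edge-sorted u<v a) ⟨
      β (cls (edge a))           ≡⟨ classLabel-adj β a ⟨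
      classLabel β u v           ≡⟨ xor-cancelˡ (O u v) (same u v) ⟩
      classLabel β' u v          ≡⟨ classLabel-adj β' a ⟩
      β' (cls (edge a))          ≡⟨ cong (β' ∘ cls) (edge-sorted u<v a) ⟩
      β' (cls (u , v , u<v , a)) ∎
      where open ≡-Reasoning

    twist-surjective : (∀ t → ∃ λ e → cls e ≡ t) → (∀ e f → cls e ≡ cls f → C-rel G e f) →
                       ∀ {T} → IsQuasiTransitiveOrientation G T →
                       ∀ O → IsQuasiTransitiveOrientation G O → ∃ λ β → _≈O_ G O (twist T β)
    twist-surjective cls-surjective cls-complete {T} isQT O isQT' =
      β , ≈O-fromEdges (proj₁ (proj₁ isQT'))
                       (⊕-supported (proj₁ (proj₁ isQT)) (classLabel-supported β)) agree
      where
      δ = T ⊕ O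
      δ-sym = ⊕-symmetric (proj₁ isQT) (proj₁ isQT')
      colour : Colouring G
      colour u v = toColour (δ u v)
      colour-QT = labelling-QTColouring δ-sym (⊕-constantOnP₃ isQT isQT')
      β : Fin k → Bool
      β t with proj₁ (cls-surjective t)
      ... | x , y , _ = δ x y
      β-edge : ∀ {u v} (a : Adj G u v) → β (cls (edge a)) ≡ δ u v
      β-edge {u} {v} a with cls-surjective (cls (edge a))
      ... | rep@(x , y , _) , rep≡ = toColour-injective (begin
        colour x y                 ≡⟨ cls-complete rep (edge a) rep≡ colour colour-QT ⟩
        colourOf G colour (edge a) ≡⟨ colourOf-edge colour (proj₁ colour-QT) a ⟩
        colour u v                 ∎)
        where open ≡-Reasoning
      agree : ∀ u v → Adj G u v → O u v ≡ twist T β u v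
      agree u v a = begin
        O u v                      ≡⟨ xor-involutiveˡ (T u v) (O u v) ⟨
        T u v xor δ u v            ≡⟨ cong (T u v xor_) (β-edge a) ⟨
        T u v xor β (cls (edge a)) ≡⟨ cong (T u v xor_) (classLabel-adj β a) ⟨
        twist T β u v              ∎
        where open ≡-Reasoning

theorem32 : ∀ (n : ℕ) (G : Graph n) (k : ℕ) →
              IsComparability G → HasClasses G k →
              HasExactlyQTOrientations G (2 ^ k)
theorem32 n G k (T , isTransitive) (cls , cls-surjective , cls-C) =
  HasExactlyQTOrientations-2^ G (twist T) (twist-cong T) (twist-QT cls-sound isQT)
    (twist-injective cls-surjective T)
    (twist-surjective cls-surjective cls-complete isQT)
  where
  open Twist G cls
  isQT = transitive⇒quasiTransitive G isTransitive
  cls-sound = λ e f → Equivalence.to (cls-C e f)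
  cls-complete = λ e f → Equivalence.from (cls-C e f)
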